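{- If a Mendelsohn triple system of order $v$ has an $\ell$-good sequencing (for an integer $\ell\ge 3$), then $\ell \leq \lfloor (v-1)/2 \rfloor$.
   Context: A cyclic triple $(x,y,z)$ consists of three distinct elements and contains the directed edges $(x,y),(y,z),(z,x)$; the cyclic triples $(x,y,z),(y,z,x),(z,x,y)$ are regarded as the same. A Mendelsohn triple system of order $v$ (MTS$(v)$) is a pair $(X,\mathcal{T})$ where $X$ is a set of $v$ points and $\mathcal{T}$ is a set of cyclic triples of elements of $X$ such that every ordered pair $(a,b)$ of distinct elements of $X$ occurs as a directed edge in exactly one triple of $\mathcal{T}$. A sequencing is a cyclic ordering $D=(i_1\; i_2\;\cdots\; i_v)$ of all points of $X$ (cyclic shifts are regarded as equal). For the total order $i_1<i_2<\cdots<i_v$, write $[x,y,z]\in\mathcal{C}(D)$ iff $x<y<z$ or $y<z<x$ or $z<x<y$ (i.e., starting at $x$ and going around $D$, one meets $y$ before $z$). A cyclic triple $(x,y,z)$ is contained in $D$ if $[x,y,z]\in\mathcal{C}(D)$. For an integer $\ell\ge 3$, $D$ is $\ell$-good if there is no triple $(x,y,z)\in\mathcal{T}$ that is contained in $D$ and such that $\{x,y,z\}$ is a subset of some $\ell$ cyclically consecutive points of $D$. -}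

module Defs where

open import Data.Nat using (ℕ; _+_; _<_)
open import Data.Fin using (Fin; toℕ)
open import Data.Fin.Permutation using (Permutation′; _⟨$⟩ʳ_)
open import Data.Product using (Σ; _×_; _,_; ∃; ∃-syntax)
open import Data.Sum using (_⊎_)
open import Relation.Binary.PropositionalEquality using (_≡_; _≢_)
open import Relation.Nullary using (¬_)

-- A (candidate) cyclic triple on the point set Fin v, written (x , y , z);
-- it has directed edges (x,y), (y,z), (z,x).
Triple : ℕ → Set
Triple v = Fin v × Fin v × Fin v

Distinct : ∀ {v} → Triple v → Set
Distinct (x , y , z) = (x ≢ y) × (y ≢ z) × (z ≢ x)

HasEdge : ∀ {v} → Triple v → Fin v → Fin v → Set
HasEdge (x , y , z) a b =
  ((a ≡ x) × (b ≡ y)) ⊎ ((a ≡ y) × (b ≡ z)) ⊎ ((a ≡ z) × (b ≡ x))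

-- A Mendelsohn triple system of order v on the point set Fin v:
-- a family of m cyclic triples T 0, …, T (m-1), each of three distinct points,
-- such that every ordered pair (a , b) of distinct points is a directed edge
-- of exactly one triple of the family.  (Exactly-one forces the triples to be
-- pairwise distinct as cyclic triples, so the family is a set.)
record MTS (v : ℕ) : Set where
  field
    m        : ℕ
    T        : Fin m → Triple v
    distinct : ∀ i → Distinct (T i)
    exactly1 : ∀ (a b : Fin v) → a ≢ b →
               Σ (Fin m) λ i → HasEdge (T i) a b ×
                 (∀ j → HasEdge (T j) a b → j ≡ i)

-- A sequencing D = (i_0 i_1 … i_{v-1}) is given by a permutation of Fin v;
-- pos D x is the position of point x in D.
Sequencing : ℕ → Set
Sequencing v = Permutation′ v

pos : ∀ {v} → Sequencing v → Fin v → ℕ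
pos D x = toℕ (D ⟨$⟩ʳ x)

InC : ∀ {v} → Sequencing v → Fin v → Fin v → Fin v → Set
InC D x y z =
  (pos D x < pos D y × pos D y < pos D z) ⊎
  (pos D y < pos D z × pos D z < pos D x) ⊎
  (pos D z < pos D x × pos D x < pos D y)

Contained : ∀ {v} → Sequencing v → Triple v → Set
Contained D (x , y , z) = InC D x y z

-- point x lies among the ℓ cyclically consecutive points of D starting at
-- position s, i.e. its position is s + k (mod v) for some k < ℓ
-- (positions are < v, so at most one wrap-around is needed).
InWindow : ∀ {v} → Sequencing v → ℕ → Fin v → Fin v → Set
InWindow {v} D ℓ s x =
  ∃[ k ] (k < ℓ × (pos D x ≡ toℕ s + k ⊎ pos D x + v ≡ toℕ s + k))

WindowTriple : ∀ {v} → Sequencing v → ℕ → Fin v → Triple v → Set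
WindowTriple D ℓ s (x , y , z) =
  InWindow D ℓ s x × InWindow D ℓ s y × InWindow D ℓ s z

Good : ∀ {v} → MTS v → ℕ → Sequencing v → Set
Good S ℓ D =
  ¬ (Σ (Fin (MTS.m S)) λ i → Σ (Fin _) λ s →
       Contained D (MTS.T S i) × WindowTriple D ℓ s (MTS.T S i))

-- Measure positions along D and let gap x y ∈ [0, v) be the number of steps from x forward to y.
-- The three gaps of a block add up to v when the block is contained in D and to 2v otherwise, and
-- for a contained block ℓ-goodness says that any two consecutive gaps add up to at least ℓ.
-- Suppose v ≤ 2ℓ.  The block through two consecutive points q, q + 1 is then contained, with gaps
-- 1, d₂, d₃ where d₂, d₃ ∈ {ℓ − 1, ℓ}, so v ∈ {2ℓ − 1, 2ℓ}; these unit blocks differ for different q.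
-- If v = 2ℓ − 1 all unit blocks have gaps 1, ℓ − 1, ℓ − 1, and the unit block starting one step
-- before the apex c of the unit block of q also contains the edge (c, q), so the two coincide,
-- which is absurd.  If v = 2ℓ each unit block has exactly one edge of gap ℓ and one of gap ℓ − 1,
-- and counting shows that every edge of these two gaps lies in a unit block.  For ℓ ≥ 4 this forces
-- the block through (q, q + 2) to be (q, q + 2, q + 1), and the blocks obtained for q and q + 1
-- share an edge; for ℓ = 3 the block through (q + 1, q) would be a unit block with a gap of 5.

module Submission where

open import Defs
open import Data.Nat using (ℕ; _≤_; _∸_; _/_)
open import Data.Nat.Base using (zero; suc; _+_; _*_; _<_; z≤n; s≤s; s≤s⁻¹; z<s; NonZero; >-nonZero)
open import Data.Nat.Properties hiding (_≟_)
open import Data.Nat.DivMod using (_%_; [m+kn]%n≡m%n; m<n⇒m%n≡m; m*n/n≡m; /-monoˡ-≤)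
open import Data.Nat.Tactic.RingSolver using (solve-∀)
open import Data.Fin.Base using (Fin; toℕ; fromℕ<; punchOut)
open import Data.Fin.Properties
  using (toℕ-injective; toℕ<n; toℕ-fromℕ<; punchOut-injective; injective⇒≤; any?; _≟_)
open import Data.Fin.Permutation using (_⟨$⟩ʳ_; _⟨$⟩ˡ_; inverseˡ; inverseʳ)
open import Data.Product using (Σ; ∃; ∃₂; _×_; _,_; proj₁; proj₂)
open import Data.Sum using (_⊎_; inj₁; inj₂; [_,_]′) renaming (map to ⊎-map)
open import Data.Empty using (⊥; ⊥-elim)
open import Function.Definitions using (Injective)
open import Relation.Binary.PropositionalEquality
open import Relation.Nullary using (yes; no)
open import Algebra.Properties.CommutativeSemigroup +-commutativeSemigroup
  using (xy∙z≈xz∙y; xy∙z≈yz∙x; xy∙z≈zx∙y)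

injective⇒surjective : ∀ {n} {f : Fin n → Fin n} → Injective _≡_ _≡_ f → ∀ y → ∃ λ x → f x ≡ y
injective⇒surjective {suc n} {f} f-injective y with any? (λ x → f x ≟ y)
... | yes hit = hit
... | no miss = ⊥-elim (1+n≰n (injective⇒≤ avoiding-y-injective))
  where
  avoiding-y : Fin (suc n) → Fin n
  avoiding-y x = punchOut {i = y} {j = f x} (λ y≡fx → miss (x , sym y≡fx))
  avoiding-y-injective : Injective _≡_ _≡_ avoiding-y
  avoiding-y-injective eq = f-injective (punchOut-injective {i = y} _ _ eq)

Cyclic : ℕ → ℕ → ℕ → Set
Cyclic x y z = (x < y × y < z) ⊎ (y < z × z < x) ⊎ (z < x × x < y)

data Offset (v x y d : ℕ) : Set where
  direct   : y ≡ x + d → Offset v x y d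
  wrapping : y + v ≡ x + d → Offset v x y d

module CyclicOffsets (v : ℕ) .{{_ : NonZero v}} where

  private variable x x′ y y′ z d d′ e d₁ d₂ d₃ : ℕ

  wraps : Offset v x y d → ℕ
  wraps (direct _) = 0
  wraps (wrapping _) = 1

  offset-wraps : (o : Offset v x y d) → y + wraps o * v ≡ x + d
  offset-wraps {y = y} (direct eq) = trans (+-identityʳ y) eq
  offset-wraps {y = y} (wrapping eq) = trans (cong (y +_) (+-identityʳ v)) eq

  residue-unique : ∀ {a b} j k → a + j * v ≡ b + k * v → a < v → b < v → a ≡ b
  residue-unique {a} {b} j k eq a<v b<v = begin
    a               ≡⟨ m<n⇒m%n≡m a<v ⟨
    a % v           ≡⟨ [m+kn]%n≡m%n a j v ⟨
    (a + j * v) % v ≡⟨ cong (_% v) eq ⟩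
    (b + k * v) % v ≡⟨ [m+kn]%n≡m%n b k v ⟩
    b % v           ≡⟨ m<n⇒m%n≡m b<v ⟩
    b               ∎
    where open ≡-Reasoning

  private
    exchange : ∀ {a b p q} → y + a ≡ p → y + b ≡ q → p + b ≡ q + a
    exchange {y} {a} {b} refl refl = xy∙z≈xz∙y y a b

  offset-unique : (o : Offset v x y d) (o′ : Offset v x y d′) → d < v → d′ < v → d ≡ d′
  offset-unique {x} {d = d} {d′} o o′ = residue-unique (wraps o′) (wraps o) (+-cancelˡ-≡ x _ _ (begin
    x + (d + wraps o′ * v)  ≡⟨ +-assoc x d _ ⟨
    x + d + wraps o′ * v    ≡⟨ exchange (offset-wraps o) (offset-wraps o′) ⟩
    x + d′ + wraps o * v    ≡⟨ +-assoc x d′ _ ⟩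
    x + (d′ + wraps o * v)  ∎))
    where open ≡-Reasoning

  offset-target-unique : (o : Offset v x y d) (o′ : Offset v x y′ d) → y < v → y′ < v → y ≡ y′
  offset-target-unique o o′ = residue-unique (wraps o) (wraps o′) (trans (offset-wraps o) (sym (offset-wraps o′)))

  offset-source-unique : (o : Offset v x y d) (o′ : Offset v x′ y d) → x < v → x′ < v → x ≡ x′
  offset-source-unique {x} {d = d} {x′} o o′ = residue-unique (wraps o′) (wraps o) (+-cancelʳ-≡ d _ _ (begin
    x + wraps o′ * v + d    ≡⟨ xy∙z≈xz∙y x _ d ⟩
    x + d + wraps o′ * v    ≡⟨ exchange (offset-wraps o) (offset-wraps o′) ⟩
    x′ + d + wraps o * v    ≡⟨ xy∙z≈xz∙y x′ d _ ⟩
    x′ + wraps o * v + d    ∎))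
    where open ≡-Reasoning

  offset-trans : Offset v x y d → Offset v y z e → x < v → d + e < v → Offset v x z (d + e)
  offset-trans {x} {d = d} {e = e} (direct refl) (direct refl) _ _ = direct (+-assoc x d e)
  offset-trans {x} {d = d} {e = e} (direct refl) (wrapping eq) _ _ = wrapping (trans eq (+-assoc x d e))
  offset-trans {x} {y} {d} {e = e} (wrapping eq) (direct refl) _ _ =
    wrapping (trans (xy∙z≈xz∙y y e v) (trans (cong (_+ e) eq) (+-assoc x d e)))
  offset-trans {x} {y} {d} {z} {e} (wrapping eq₁) (wrapping eq₂) x<v d+e<v = ⊥-elim (<-irrefl refl (begin-strict
    v + v           ≤⟨ m≤n+m (v + v) z ⟩
    z + (v + v)     ≡⟨ +-assoc z v v ⟨
    z + v + v       ≡⟨ cong (_+ v) eq₂ ⟩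
    y + e + v       ≡⟨ xy∙z≈xz∙y y e v ⟩
    y + v + e       ≡⟨ cong (_+ e) eq₁ ⟩
    x + d + e       ≡⟨ +-assoc x d e ⟩
    x + (d + e)     <⟨ +-mono-< x<v d+e<v ⟩
    v + v           ∎))
    where open ≤-Reasoning

  private
    before : y ≡ x + d → 0 < d → x < y
    before {x = x} refl 0<d = m<m+n x 0<d

  cycle-wraps : (o₁ : Offset v x y d₁) (o₂ : Offset v y z d₂) (o₃ : Offset v z x d₃) →
                (wraps o₁ + wraps o₂ + wraps o₃) * v ≡ d₁ + d₂ + d₃
  cycle-wraps {x} {y} {d₁} {z} {d₂} {d₃} o₁ o₂ o₃ = +-cancelˡ-≡ (x + y + z) _ _ (begin
    x + y + z + (wraps o₁ + wraps o₂ + wraps o₃) * v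
      ≡⟨ spread x y z (wraps o₁) (wraps o₂) (wraps o₃) v ⟩
    (x + wraps o₃ * v) + (y + wraps o₁ * v) + (z + wraps o₂ * v)
      ≡⟨ cong₂ _+_ (cong₂ _+_ (offset-wraps o₃) (offset-wraps o₁)) (offset-wraps o₂) ⟩
    (z + d₃) + (x + d₁) + (y + d₂)
      ≡⟨ gather x y z d₁ d₂ d₃ ⟩
    x + y + z + (d₁ + d₂ + d₃) ∎)
    where
    open ≡-Reasoning
    spread : ∀ x y z a b c n → x + y + z + (a + b + c) * n ≡ (x + c * n) + (y + a * n) + (z + b * n)
    spread = solve-∀
    gather : ∀ x y z a b c → (z + c) + (x + a) + (y + b) ≡ x + y + z + (a + b + c)
    gather = solve-∀

  multiple-below-3v : ∀ k {s} → k * v ≡ s → 0 < s → s < v + v + v → s ≡ v ⊎ s ≡ v + v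
  multiple-below-3v 0 refl ()
  multiple-below-3v 1 refl _ _ = inj₁ (+-identityʳ v)
  multiple-below-3v 2 refl _ _ = inj₂ (cong (v +_) (+-identityʳ v))
  multiple-below-3v (suc (suc (suc k))) refl _ s<3v = ⊥-elim (<-irrefl refl (begin-strict
    v + v + v                 ≡⟨ +-assoc v v v ⟩
    v + (v + v)               ≤⟨ +-monoʳ-≤ v (+-monoʳ-≤ v (m≤m+n v _)) ⟩
    v + (v + (v + k * v))     <⟨ s<3v ⟩
    v + v + v                 ∎))
    where open ≤-Reasoning

  offset-cycle : (o₁ : Offset v x y d₁) (o₂ : Offset v y z d₂) (o₃ : Offset v z x d₃) →
                 0 < d₁ → d₁ < v → d₂ < v → d₃ < v → d₁ + d₂ + d₃ ≡ v ⊎ d₁ + d₂ + d₃ ≡ v + v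
  offset-cycle {d₁ = d₁} {d₂ = d₂} {d₃ = d₃} o₁ o₂ o₃ 0<d₁ d₁<v d₂<v d₃<v =
    multiple-below-3v (wraps o₁ + wraps o₂ + wraps o₃) (cycle-wraps o₁ o₂ o₃)
      (<-≤-trans 0<d₁ (≤-trans (m≤m+n d₁ d₂) (m≤m+n (d₁ + d₂) d₃)))
      (+-mono-< (+-mono-< d₁<v d₂<v) d₃<v)

  one-wrap-cyclic : (o₁ : Offset v x y d₁) (o₂ : Offset v y z d₂) (o₃ : Offset v z x d₃) →
                    0 < d₁ → 0 < d₂ → 0 < d₃ → wraps o₁ + wraps o₂ + wraps o₃ ≡ 1 → Cyclic x y z
  one-wrap-cyclic (direct e₁)   (direct e₂)   (wrapping _)  p₁ p₂ _  _ = inj₁ (before e₁ p₁ , before e₂ p₂)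
  one-wrap-cyclic (wrapping _)  (direct e₂)   (direct e₃)   _  p₂ p₃ _ = inj₂ (inj₁ (before e₂ p₂ , before e₃ p₃))
  one-wrap-cyclic (direct e₁)   (wrapping _)  (direct e₃)   p₁ _  p₃ _ = inj₂ (inj₂ (before e₃ p₃ , before e₁ p₁))
  one-wrap-cyclic (direct _)    (direct _)    (direct _)    _  _  _  ()
  one-wrap-cyclic (direct _)    (wrapping _)  (wrapping _)  _  _  _  ()
  one-wrap-cyclic (wrapping _)  (direct _)    (wrapping _)  _  _  _  ()
  one-wrap-cyclic (wrapping _)  (wrapping _)  (direct _)    _  _  _  ()
  one-wrap-cyclic (wrapping _)  (wrapping _)  (wrapping _)  _  _  _  ()

  offset-cyclic : (o₁ : Offset v x y d₁) (o₂ : Offset v y z d₂) (o₃ : Offset v z x d₃) →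
                  0 < d₁ → 0 < d₂ → 0 < d₃ → d₁ + d₂ + d₃ ≡ v → Cyclic x y z
  offset-cyclic o₁ o₂ o₃ p₁ p₂ p₃ s = one-wrap-cyclic o₁ o₂ o₃ p₁ p₂ p₃
    (*-cancelʳ-≡ _ 1 v (trans (cycle-wraps o₁ o₂ o₃) (trans s (sym (*-identityˡ v)))))

  offset-exists : x < v → y < v → ∃ λ d → d < v × Offset v x y d
  offset-exists {x} {y} x<v y<v with x ≤? y
  ... | yes x≤y = y ∸ x , ≤-<-trans (m∸n≤m y x) y<v , direct (sym (m+[n∸m]≡n x≤y))
  ... | no x≰y = y + v ∸ x ,
                 +-cancelˡ-< x _ v (subst (_< x + v) (sym (m+[n∸m]≡n x≤y+v)) (+-monoˡ-< v (≰⇒> x≰y))) ,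
                 wrapping (sym (m+[n∸m]≡n x≤y+v))
    where x≤y+v = ≤-trans (<⇒≤ x<v) (m≤n+m v y)

  offset-target-exists : x < v → d < v → ∃ λ y → y < v × Offset v x y d
  offset-target-exists {x} {d} x<v d<v with x + d <? v
  ... | yes x+d<v = x + d , x+d<v , direct refl
  ... | no x+d≮v = x + d ∸ v ,
                   +-cancelʳ-< v _ v (subst (_< v + v) (sym (m∸n+n≡m (≮⇒≥ x+d≮v))) (+-mono-< x<v d<v)) ,
                   wrapping (m∸n+n≡m (≮⇒≥ x+d≮v))

  offset-source-exists : y < v → d < v → ∃ λ x → x < v × Offset v x y d
  offset-source-exists {y} {d} y<v d<v with d ≤? y
  ... | yes d≤y = y ∸ d , ≤-<-trans (m∸n≤m y d) y<v , direct (sym (m∸n+n≡m d≤y))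
  ... | no d≰y = y + v ∸ d ,
                 +-cancelʳ-< d _ v (subst (_< v + d) (sym (m∸n+n≡m d≤y+v))
                                          (subst (y + v <_) (+-comm d v) (+-monoˡ-< v (≰⇒> d≰y)))) ,
                 wrapping (sym (m∸n+n≡m d≤y+v))
    where d≤y+v = ≤-trans (<⇒≤ d<v) (m≤n+m v y)

module _ where

  LongGap : ℕ → ℕ → Set
  LongGap ℓ d = suc d ≡ ℓ ⊎ d ≡ ℓ

  private variable
    a b d e v ℓ : ℕ

  private
    suc+suc : ∀ a b → suc a + suc b ≡ suc (suc (a + b))
    suc+suc a b = cong suc (+-suc a b)

  long-gap : ℓ ≤ suc d → d ≤ ℓ → LongGap ℓ d
  long-gap ℓ≤1+d d≤ℓ with m≤n⇒m<n∨m≡n d≤ℓ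
  ... | inj₁ d<ℓ = inj₁ (≤-antisym d<ℓ ℓ≤1+d)
  ... | inj₂ d≡ℓ = inj₂ d≡ℓ

  long-gap-≥2 : 3 ≤ ℓ → LongGap ℓ d → 2 ≤ d
  long-gap-≥2 3≤ℓ (inj₁ refl) = s≤s⁻¹ 3≤ℓ
  long-gap-≥2 3≤ℓ (inj₂ refl) = ≤-trans (n≤1+n 2) 3≤ℓ

  long-gaps : ℓ ≤ suc a → ℓ ≤ suc b → suc (a + b) ≤ ℓ + ℓ → LongGap ℓ a × LongGap ℓ b
  long-gaps {ℓ} {a} {b} ℓ≤1+a ℓ≤1+b sum≤ =
    long-gap ℓ≤1+a (+-cancelʳ-≤ ℓ a ℓ (≤-trans (subst (a + ℓ ≤_) (+-suc a b) (+-monoʳ-≤ a ℓ≤1+b)) sum≤)) ,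
    long-gap ℓ≤1+b (+-cancelˡ-≤ ℓ b ℓ (≤-trans (+-monoˡ-≤ b ℓ≤1+a) sum≤))

  long-gaps-parity : ℓ ≤ suc a → ℓ ≤ suc b → suc (a + b) ≤ ℓ + ℓ →
                     suc (a + b) ≡ ℓ + ℓ ⊎ suc (suc (a + b)) ≡ ℓ + ℓ
  long-gaps-parity {ℓ} {a} {b} ℓ≤1+a ℓ≤1+b sum≤ with m≤n⇒m<n∨m≡n sum≤
  ... | inj₂ eq = inj₁ eq
  ... | inj₁ lt = inj₂ (≤-antisym lt (subst (ℓ + ℓ ≤_) (suc+suc a b) (+-mono-≤ ℓ≤1+a ℓ≤1+b)))

  odd-long-gap : ℓ ≤ suc a → ℓ ≤ suc b → suc (suc (a + b)) ≡ ℓ + ℓ → suc a ≡ ℓ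
  odd-long-gap {ℓ} {a} {b} ℓ≤1+a ℓ≤1+b sum≡ = ≤-antisym
    (+-cancelʳ-≤ ℓ (suc a) ℓ (subst (suc a + ℓ ≤_) (trans (suc+suc a b) sum≡) (+-monoʳ-≤ (suc a) ℓ≤1+b)))
    ℓ≤1+a

  even-long-gaps : ℓ ≤ suc a → ℓ ≤ suc b → suc (a + b) ≡ ℓ + ℓ →
                   (a ≡ ℓ × suc b ≡ ℓ) ⊎ (suc a ≡ ℓ × b ≡ ℓ)
  even-long-gaps {ℓ} {a} {b} ℓ≤1+a ℓ≤1+b sum≡ with long-gaps ℓ≤1+a ℓ≤1+b (≤-reflexive sum≡)
  ... | inj₂ refl , _ = inj₁ (refl , +-cancelˡ-≡ a _ _ (trans (+-suc a b) sum≡))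
  ... | inj₁ refl , _ = inj₂ (refl , +-cancelˡ-≡ (suc a) _ _ sum≡)

  long-gap-choice : (a ≡ ℓ × suc b ≡ ℓ) ⊎ (suc a ≡ ℓ × b ≡ ℓ) → LongGap ℓ e → e ≡ a ⊎ e ≡ b
  long-gap-choice (inj₁ (refl , b+1≡a)) (inj₁ e+1≡a) = inj₂ (suc-injective (trans e+1≡a (sym b+1≡a)))
  long-gap-choice (inj₁ (refl , _))     (inj₂ refl)    = inj₁ refl
  long-gap-choice (inj₂ (_ , refl))     (inj₂ refl)    = inj₂ refl
  long-gap-choice (inj₂ (a+1≡b , refl)) (inj₁ e+1≡b)   = inj₁ (suc-injective (trans e+1≡b (sym a+1≡b)))

  skip-long-gaps : ℓ ≤ b + 2 → ℓ ≤ 2 + a → 2 + a + b ≡ ℓ + ℓ → LongGap ℓ a ⊎ LongGap ℓ b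
  skip-long-gaps {ℓ} {b} {a} ℓ≤b+2 ℓ≤2+a sum≡ with ℓ ≤? suc a
  ... | yes ℓ≤1+a = inj₁ (long-gap ℓ≤1+a (+-cancelʳ-≤ ℓ a ℓ (≤-trans (+-monoʳ-≤ a ℓ≤b+2) (≤-reflexive a+b+2≡ℓ+ℓ))))
    where
    a+b+2≡ℓ+ℓ : a + (b + 2) ≡ ℓ + ℓ
    a+b+2≡ℓ+ℓ = trans (trans (sym (+-assoc a b 2)) (+-comm (a + b) 2)) sum≡
  ... | no ℓ≰1+a = inj₂ (inj₂ (+-cancelˡ-≡ ℓ _ _ (trans (sym (cong (_+ b) 2+a≡ℓ)) sum≡)))
    where
    2+a≡ℓ : 2 + a ≡ ℓ
    2+a≡ℓ = ≤-antisym (≰⇒> ℓ≰1+a) ℓ≤2+a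

  suc-sum≢double : a < v → b < v → suc (a + b) ≢ v + v
  suc-sum≢double {a} {v} {b} a<v b<v eq =
    <-irrefl eq (subst (_≤ v + v) (suc+suc a b) (+-mono-≤ a<v b<v))

  double-sum-maximal : a < v → b < v → suc (suc (a + b)) ≡ v + v → suc b ≡ v
  double-sum-maximal {a} {v} {b} a<v b<v eq =
    ≤-antisym b<v (+-cancelˡ-≤ v v (suc b) (subst (_≤ v + suc b) (trans (suc+suc a b) eq) (+-monoˡ-≤ (suc b) a<v)))

  seven-long-gaps : ∀ a b → a + b ≡ 7 → a < 6 → b < 6 → LongGap 3 a ⊎ LongGap 3 b
  seven-long-gaps 0 _ refl _ (s≤s (s≤s (s≤s (s≤s (s≤s (s≤s ()))))))
  seven-long-gaps 1 _ refl _ (s≤s (s≤s (s≤s (s≤s (s≤s (s≤s ()))))))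
  seven-long-gaps 2 _ refl _ _ = inj₁ (inj₁ refl)
  seven-long-gaps 3 _ refl _ _ = inj₁ (inj₂ refl)
  seven-long-gaps 4 _ refl _ _ = inj₂ (inj₂ refl)
  seven-long-gaps 5 _ refl _ _ = inj₂ (inj₁ refl)
  seven-long-gaps (suc (suc (suc (suc (suc (suc a)))))) _ _ (s≤s (s≤s (s≤s (s≤s (s≤s (s≤s ())))))) _

  long-gap-bound : LongGap ℓ d → ℓ ≤ suc d
  long-gap-bound (inj₁ refl) = ≤-refl
  long-gap-bound (inj₂ refl) = n≤1+n _

data Rotation {v : ℕ} : Triple v → Fin v → Fin v → Fin v → Set where
  rot₀ : ∀ {x y z} → Rotation (x , y , z) x y z
  rot₁ : ∀ {x y z} → Rotation (z , x , y) x y z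
  rot₂ : ∀ {x y z} → Rotation (y , z , x) x y z

module _ {v : ℕ} where

  private variable
    t : Triple v
    a b x y z : Fin v

  rotate : Rotation t x y z → Rotation t y z x
  rotate rot₀ = rot₁
  rotate rot₁ = rot₂
  rotate rot₂ = rot₀

  rotation-distinct : Rotation t x y z → Distinct t → Distinct (x , y , z)
  rotation-distinct rot₀ d = d
  rotation-distinct rot₁ (zx , xy , yz) = xy , yz , zx
  rotation-distinct rot₂ (yz , zx , xy) = xy , yz , zx

  rotation-edge : Rotation t x y z → HasEdge t x y
  rotation-edge rot₀ = inj₁ (refl , refl)
  rotation-edge rot₁ = inj₂ (inj₁ (refl , refl))
  rotation-edge rot₂ = inj₂ (inj₂ (refl , refl))

  rotation-edge⁻ : Rotation t x y z → HasEdge t a b → HasEdge (x , y , z) a b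
  rotation-edge⁻ rot₀ e = e
  rotation-edge⁻ rot₁ (inj₁ zx) = inj₂ (inj₂ zx)
  rotation-edge⁻ rot₁ (inj₂ (inj₁ xy)) = inj₁ xy
  rotation-edge⁻ rot₁ (inj₂ (inj₂ yz)) = inj₂ (inj₁ yz)
  rotation-edge⁻ rot₂ (inj₁ yz) = inj₂ (inj₁ yz)
  rotation-edge⁻ rot₂ (inj₂ (inj₁ zx)) = inj₂ (inj₂ zx)
  rotation-edge⁻ rot₂ (inj₂ (inj₂ xy)) = inj₁ xy

  edge-rotation : HasEdge t a b → ∃ λ c → Rotation t a b c
  edge-rotation {t = _ , _ , z} (inj₁ (refl , refl)) = z , rot₀
  edge-rotation {t = x , _ , _} (inj₂ (inj₁ (refl , refl))) = x , rot₁
  edge-rotation {t = _ , y , _} (inj₂ (inj₂ (refl , refl))) = y , rot₂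

  rotation-contained : (D : Sequencing v) → Rotation t x y z → InC D x y z → Contained D t
  rotation-contained D rot₀ c = c
  rotation-contained D rot₁ (inj₁ c) = inj₂ (inj₁ c)
  rotation-contained D rot₁ (inj₂ (inj₁ c)) = inj₂ (inj₂ c)
  rotation-contained D rot₁ (inj₂ (inj₂ c)) = inj₁ c
  rotation-contained D rot₂ (inj₁ c) = inj₂ (inj₂ c)
  rotation-contained D rot₂ (inj₂ (inj₁ c)) = inj₁ c
  rotation-contained D rot₂ (inj₂ (inj₂ c)) = inj₂ (inj₁ c)

  rotation-window : ∀ {D ℓ s} → Rotation t x y z → WindowTriple D ℓ s (x , y , z) → WindowTriple D ℓ s t
  rotation-window rot₀ w = w
  rotation-window rot₁ (wx , wy , wz) = wz , wx , wy
  rotation-window rot₂ (wx , wy , wz) = wy , wz , wx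

module Gaps {v : ℕ} .{{_ : NonZero v}} (D : Sequencing v) where
  open CyclicOffsets v

  private variable
    x x′ y y′ z : Fin v
    d : ℕ

  pos<v : ∀ x → pos D x < v
  pos<v x = toℕ<n (D ⟨$⟩ʳ x)

  pos-injective : pos D x ≡ pos D y → x ≡ y
  pos-injective {x} {y} eq = begin
    x                    ≡⟨ inverseˡ D ⟨
    D ⟨$⟩ˡ (D ⟨$⟩ʳ x)    ≡⟨ cong (D ⟨$⟩ˡ_) (toℕ-injective eq) ⟩
    D ⟨$⟩ˡ (D ⟨$⟩ʳ y)    ≡⟨ inverseˡ D ⟩
    y                    ∎
    where open ≡-Reasoning

  point-at : ∀ {i} → i < v → ∃ λ x → pos D x ≡ i
  point-at i<v = D ⟨$⟩ˡ fromℕ< i<v , trans (cong toℕ (inverseʳ D)) (toℕ-fromℕ< i<v)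

  -- Abstract so that type checking never unfolds the witnesses chosen here.
  abstract
    gap : Fin v → Fin v → ℕ
    gap x y = proj₁ (offset-exists (pos<v x) (pos<v y))

    gap<v : gap x y < v
    gap<v {x} {y} = proj₁ (proj₂ (offset-exists (pos<v x) (pos<v y)))

    gap-offset : Offset v (pos D x) (pos D y) (gap x y)
    gap-offset {x} {y} = proj₂ (proj₂ (offset-exists (pos<v x) (pos<v y)))

  gap-unique : Offset v (pos D x) (pos D y) d → d < v → gap x y ≡ d
  gap-unique o d<v = offset-unique gap-offset o gap<v d<v

  gap-injectiveʳ : gap x y ≡ gap x y′ → y ≡ y′
  gap-injectiveʳ {x} {y} {y′} eq =
    pos-injective (offset-target-unique gap-offset (subst (Offset v (pos D x) (pos D y′)) (sym eq) gap-offset)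
                                        (pos<v y) (pos<v y′))

  gap-injectiveˡ : gap x y ≡ gap x′ y → x ≡ x′
  gap-injectiveˡ {x} {y} {x′} eq =
    pos-injective (offset-source-unique gap-offset (subst (Offset v (pos D x′) (pos D y)) (sym eq) gap-offset)
                                        (pos<v x) (pos<v x′))

  gap-self : gap x x ≡ 0
  gap-self {x} = gap-unique (direct (sym (+-identityʳ (pos D x)))) (≤-<-trans z≤n (pos<v x))

  gap-positive : x ≢ y → 0 < gap x y
  gap-positive {x} {y} x≢y with gap x y in eq
  ... | zero = ⊥-elim (x≢y (sym (gap-injectiveʳ (trans eq (sym gap-self)))))
  ... | suc _ = s≤s z≤n

  gap-+ : gap x y + gap y z < v → gap x z ≡ gap x y + gap y z
  gap-+ {x} lt = gap-unique (offset-trans gap-offset gap-offset (pos<v x) lt) lt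

  gap-target-exists : d < v → ∃ λ y → gap x y ≡ d
  gap-target-exists {d} {x} d<v with offset-target-exists (pos<v x) d<v
  ... | i , i<v , o with point-at i<v
  ... | y , refl = y , gap-unique o d<v

  gap-source-exists : d < v → ∃ λ x → gap x y ≡ d
  gap-source-exists {d} {y} d<v with offset-source-exists (pos<v y) d<v
  ... | i , i<v , o with point-at i<v
  ... | x , refl = x , gap-unique o d<v

  gap-cycle : x ≢ y → gap x y + gap y z + gap z x ≡ v ⊎ gap x y + gap y z + gap z x ≡ v + v
  gap-cycle x≢y = offset-cycle gap-offset gap-offset gap-offset (gap-positive x≢y) gap<v gap<v gap<v

  gap-flip : x ≢ y → gap x y + gap y x ≡ v
  gap-flip {x} {y} x≢y =
    [ trans (sym through-y) , (λ s → ⊥-elim (<-irrefl (trans (sym through-y) s) (+-mono-< gap<v gap<v))) ]′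
      (gap-cycle x≢y)
    where
    through-y : gap x y + gap y y + gap y x ≡ gap x y + gap y x
    through-y = cong (_+ gap y x) (trans (cong (gap x y +_) gap-self) (+-identityʳ (gap x y)))

  gap-cyclic : x ≢ y → y ≢ z → z ≢ x → gap x y + gap y z + gap z x ≡ v → InC D x y z
  gap-cyclic x≢y y≢z z≢x =
    offset-cyclic gap-offset gap-offset gap-offset (gap-positive x≢y) (gap-positive y≢z) (gap-positive z≢x)

  in-window : ∀ {ℓ} → gap x y < ℓ → InWindow D ℓ (D ⟨$⟩ʳ x) y
  in-window {x} {y} lt = gap x y , lt , as-sum gap-offset
    where
    as-sum : ∀ {i j d} → Offset v i j d → j ≡ i + d ⊎ j + v ≡ i + d
    as-sum (direct eq) = inj₁ eq
    as-sum (wrapping eq) = inj₂ eq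

module Blocks {v : ℕ} (S : MTS v) where
  open MTS S

  private variable
    a b : Fin v
    k k′ : Fin m

  block-of-edge : a ≢ b → Σ (Fin m) λ k → ∃ λ c → Rotation (T k) a b c
  block-of-edge {a} {b} a≢b with exactly1 a b a≢b
  ... | k , e , _ = k , edge-rotation e

  same-block : a ≢ b → HasEdge (T k) a b → HasEdge (T k′) a b → k ≡ k′
  same-block {a} {b} a≢b e e′ with exactly1 a b a≢b
  ... | _ , _ , unique = trans (unique _ e) (sym (unique _ e′))

module Windows {v ℓ : ℕ} .{{_ : NonZero v}} (S : MTS v) (D : Sequencing v) (good : Good S ℓ D) where
  open MTS S
  open Gaps D

  private variable
    a b c : Fin v
    k : Fin m

  -- Otherwise the ℓ points starting at b would contain the whole block.
  window-bound : Rotation (T k) a b c → gap a b + gap b c + gap c a ≡ v → ℓ ≤ gap b c + gap c a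
  window-bound {k} {a} {b} {c} r s = ≮⇒≥ λ short →
    good (k , D ⟨$⟩ʳ b , rotation-contained D r (gap-cyclic a≢b b≢c c≢a s) ,
          rotation-window {D = D} {ℓ} {D ⟨$⟩ʳ b} r (in-window (subst (_< ℓ) (sym b-to-a) short) ,
                             in-window (subst (_< ℓ) (sym gap-self) (≤-<-trans z≤n short)) ,
                             in-window (≤-<-trans (m≤m+n (gap b c) (gap c a)) short)))
    where
    a≢b = proj₁ (rotation-distinct r (distinct k))
    b≢c = proj₁ (proj₂ (rotation-distinct r (distinct k)))
    c≢a = proj₂ (proj₂ (rotation-distinct r (distinct k)))
    b-to-a : gap b a ≡ gap b c + gap c a
    b-to-a = gap-+ (subst (gap b c + gap c a <_) (trans (sym (+-assoc (gap a b) _ _)) s)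
                          (m<n+m (gap b c + gap c a) (gap-positive a≢b)))

  window-bounds : Rotation (T k) a b c → gap a b + gap b c + gap c a ≡ v →
                  ℓ ≤ gap b c + gap c a × ℓ ≤ gap c a + gap a b × ℓ ≤ gap a b + gap b c
  window-bounds {a = a} {b} {c} r s =
    window-bound r s ,
    window-bound (rotate r) (trans (sym (xy∙z≈yz∙x (gap a b) (gap b c) (gap c a))) s) ,
    window-bound (rotate (rotate r)) (trans (sym (xy∙z≈zx∙y (gap a b) (gap b c) (gap c a))) s)

module LongWindow {v ℓ : ℕ} .{{_ : NonZero v}} (S : MTS v) (D : Sequencing v) (good : Good S ℓ D)
                    (3≤ℓ : 3 ≤ ℓ) (v≤ℓ+ℓ : v ≤ ℓ + ℓ) (1<v : 1 < v) where
  open MTS S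
  open Gaps D
  open Blocks S
  open Windows S D good

  private variable
    a b c x y : Fin v
    k : Fin m

  positive-gap⇒≢ : 0 < gap a b → a ≢ b
  positive-gap⇒≢ 0<gap refl = <-irrefl (sym gap-self) 0<gap

  unit-gap⇒≢ : gap a b ≡ 1 → a ≢ b
  unit-gap⇒≢ ab≡1 = positive-gap⇒≢ (subst (0 <_) (sym ab≡1) z<s)

  long-gap-≢1 : ∀ {d} → LongGap ℓ d → d ≢ 1
  long-gap-≢1 long refl with long-gap-≥2 3≤ℓ long
  ... | s≤s ()

  long-gap-≢0 : ∀ {d} → LongGap ℓ d → d ≢ 0
  long-gap-≢0 long refl with long-gap-≥2 3≤ℓ long
  ... | ()

  long-gap⇒≢ : LongGap ℓ (gap a b) → a ≢ b
  long-gap⇒≢ long = positive-gap⇒≢ (≤-trans (s≤s z≤n) (long-gap-≥2 3≤ℓ long))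

  origin : Fin v
  origin = proj₁ (point-at (<-trans z<s 1<v))

  successor : ∀ a → ∃ λ b → gap a b ≡ 1
  successor a = gap-target-exists 1<v

  record UnitBlock (q : Fin v) : Set where
    field
      next apex : Fin v
      block : Fin m
      rotation : Rotation (T block) q next apex
      unit : gap q next ≡ 1

  abstract
    unit-block : ∀ q → UnitBlock q
    unit-block q with successor q
    ... | n , unit with block-of-edge (unit-gap⇒≢ unit)
    ... | k , c , r = record { next = n ; apex = c ; block = k ; rotation = r ; unit = unit }

  open module UnitBlockOf (q : Fin v) = UnitBlock (unit-block q)

  middle-gap last-gap : Fin v → ℕ
  middle-gap q = gap (next q) (apex q)
  last-gap q = gap (apex q) q

  unit-block-cycle : ∀ q → gap q (next q) + middle-gap q + last-gap q ≡ suc (middle-gap q + last-gap q)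
  unit-block-cycle q = cong (λ g → g + middle-gap q + last-gap q) (unit q)

  unit-block-sum : ∀ q → suc (middle-gap q + last-gap q) ≡ v
  unit-block-sum q =
    [ trans (sym (unit-block-cycle q)) ,
      (λ s → ⊥-elim (suc-sum≢double gap<v gap<v (trans (sym (unit-block-cycle q)) s))) ]′
    (gap-cycle (unit-gap⇒≢ (unit q)))

  unit-block-window : ∀ q → ℓ ≤ gap (apex q) q + gap q (next q) × ℓ ≤ gap q (next q) + gap (next q) (apex q)
  unit-block-window q = proj₂ (window-bounds (rotation q) (trans (unit-block-cycle q) (unit-block-sum q)))

  unit-block-bounds : ∀ q → ℓ ≤ suc (middle-gap q) × ℓ ≤ suc (last-gap q)
  unit-block-bounds q =
    subst (λ g → ℓ ≤ g + middle-gap q) (unit q) (proj₂ (unit-block-window q)) ,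
    subst (ℓ ≤_) (trans (cong (last-gap q +_) (unit q)) (+-comm (last-gap q) 1)) (proj₁ (unit-block-window q))

  unit-block-long : ∀ q → LongGap ℓ (middle-gap q) × LongGap ℓ (last-gap q)
  unit-block-long q = long-gaps (proj₁ (unit-block-bounds q)) (proj₂ (unit-block-bounds q))
                                (subst (_≤ ℓ + ℓ) (sym (unit-block-sum q)) v≤ℓ+ℓ)

  unit-block-injective : ∀ {q q′} → block q ≡ block q′ → q ≡ q′
  unit-block-injective {q} {q′} eq = from-edge (rotation-edge⁻ (rotation q) edge)
    where
    edge : HasEdge (T (block q)) q′ (next q′)
    edge = subst (λ k → HasEdge (T k) q′ (next q′)) (sym eq) (rotation-edge (rotation q′))
    from-edge : HasEdge (q , next q , apex q) q′ (next q′) → q ≡ q′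
    from-edge (inj₁ (q′≡q , _)) = sym q′≡q
    from-edge (inj₂ (inj₁ (q′≡n , n′≡c))) =
      ⊥-elim (long-gap-≢1 (proj₁ (unit-block-long q)) (trans (cong₂ gap (sym q′≡n) (sym n′≡c)) (unit q′)))
    from-edge (inj₂ (inj₂ (q′≡c , n′≡q))) =
      ⊥-elim (long-gap-≢1 (proj₂ (unit-block-long q)) (trans (cong₂ gap (sym q′≡c) (sym n′≡q)) (unit q′)))

  unit-block-gaps : ∀ q → Rotation (T (block q)) a b c → gap a b ≡ 1 ⊎ LongGap ℓ (gap a b)
  unit-block-gaps q r with rotation-edge⁻ (rotation q) (rotation-edge r)
  ... | inj₁ (refl , refl) = inj₁ (unit q)
  ... | inj₂ (inj₁ (refl , refl)) = inj₂ (proj₁ (unit-block-long q))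
  ... | inj₂ (inj₂ (refl , refl)) = inj₂ (proj₂ (unit-block-long q))

  parity : v ≡ ℓ + ℓ ⊎ suc v ≡ ℓ + ℓ
  parity = ⊎-map (trans (sym (unit-block-sum origin))) (trans (cong suc (sym (unit-block-sum origin))))
    (long-gaps-parity (proj₁ (unit-block-bounds origin)) (proj₂ (unit-block-bounds origin))
                      (subst (_≤ ℓ + ℓ) (sym (unit-block-sum origin)) v≤ℓ+ℓ))

  odd-impossible : suc v ≡ ℓ + ℓ → ⊥
  odd-impossible odd = long-gap-≢0 (proj₁ (unit-block-long q)) middle-q≡0
    where
    q = origin
    p = apex q
    r = proj₁ (gap-source-exists {y = p} 1<v)
    r-to-p : gap r p ≡ 1
    r-to-p = proj₂ (gap-source-exists 1<v)
    odd-long : ∀ {a b} → ℓ ≤ suc a → ℓ ≤ suc b → suc (a + b) ≡ v → suc a ≡ ℓ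
    odd-long ℓ≤1+a ℓ≤1+b sum = odd-long-gap ℓ≤1+a ℓ≤1+b (trans (cong suc sum) odd)
    next-r≡p : next r ≡ p
    next-r≡p = gap-injectiveʳ (trans (unit r) (sym r-to-p))
    middle-r≡last-q : middle-gap r ≡ last-gap q
    middle-r≡last-q = suc-injective (trans
      (odd-long (proj₁ (unit-block-bounds r)) (proj₂ (unit-block-bounds r)) (unit-block-sum r))
      (sym (odd-long (proj₂ (unit-block-bounds q)) (proj₁ (unit-block-bounds q))
                     (trans (cong suc (+-comm (last-gap q) (middle-gap q))) (unit-block-sum q)))))
    apex-r≡q : apex r ≡ q
    apex-r≡q = gap-injectiveʳ (trans (cong (λ n → gap n (apex r)) (sym next-r≡p)) middle-r≡last-q)
    p≢q : p ≢ q
    p≢q = proj₂ (proj₂ (rotation-distinct (rotation q) (distinct (block q))))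
    r≡q : r ≡ q
    r≡q = unit-block-injective (same-block p≢q
      (subst₂ (HasEdge (T (block r))) next-r≡p apex-r≡q (rotation-edge (rotate (rotation r))))
      (rotation-edge (rotate (rotate (rotation q)))))
    p≡next-q : p ≡ next q
    p≡next-q = gap-injectiveʳ (trans (subst (λ s → gap s p ≡ 1) r≡q r-to-p) (sym (unit q)))
    middle-q≡0 : middle-gap q ≡ 0
    middle-q≡0 = trans (cong (gap (next q)) p≡next-q) gap-self

  module Even (even : v ≡ ℓ + ℓ) where

    abstract
      unit-long-edge : ∀ {e} → LongGap ℓ e → ∀ q → ∃₂ λ s t → gap s t ≡ e × HasEdge (T (block q)) s t
      unit-long-edge {e} long q = pick (long-gap-choice
        (even-long-gaps (proj₁ (unit-block-bounds q)) (proj₂ (unit-block-bounds q)) (trans (unit-block-sum q) even)) long)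
        where
        pick : e ≡ middle-gap q ⊎ e ≡ last-gap q → ∃₂ λ s t → gap s t ≡ e × HasEdge (T (block q)) s t
        pick (inj₁ e≡middle) = next q , apex q , sym e≡middle , rotation-edge (rotate (rotation q))
        pick (inj₂ e≡last)   = apex q , q , sym e≡last , rotation-edge (rotate (rotate (rotation q)))

    -- The unit blocks are distinct and each has exactly one edge of gap e, so these edges have
    -- distinct sources; by counting, every point is such a source.
    long-edge-in-unit-block : ∀ {e} → LongGap ℓ e → gap a b ≡ e → ∃ λ q → HasEdge (T (block q)) a b
    long-edge-in-unit-block {a} {b} {e} long ab≡e = q , subst₂ (HasEdge (T (block q))) source≡a target≡b (edge q)
      where
      source target : Fin v → Fin v
      source q = proj₁ (unit-long-edge long q)
      target q = proj₁ (proj₂ (unit-long-edge long q))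
      edge-gap : ∀ q → gap (source q) (target q) ≡ e
      edge-gap q = proj₁ (proj₂ (proj₂ (unit-long-edge long q)))
      edge : ∀ q → HasEdge (T (block q)) (source q) (target q)
      edge q = proj₂ (proj₂ (proj₂ (unit-long-edge long q)))
      source≢target : ∀ q → source q ≢ target q
      source≢target q = long-gap⇒≢ (subst (LongGap ℓ) (sym (edge-gap q)) long)
      same-target : ∀ {q q′} → source q ≡ source q′ → target q ≡ target q′
      same-target {q} {q′} eq =
        gap-injectiveʳ (trans (edge-gap q) (sym (subst (λ s → gap s (target q′) ≡ e) (sym eq) (edge-gap q′))))
      source-injective : Injective _≡_ _≡_ source
      source-injective {q} {q′} eq = unit-block-injective (same-block (source≢target q) (edge q)
        (subst₂ (HasEdge (T (block q′))) (sym eq) (sym (same-target eq)) (edge q′)))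
      q = proj₁ (injective⇒surjective source-injective a)
      source≡a : source q ≡ a
      source≡a = proj₂ (injective⇒surjective source-injective a)
      target≡b : target q ≡ b
      target≡b = gap-injectiveʳ (trans (edge-gap q) (sym (subst (λ s → gap s b ≡ e) (sym source≡a) ab≡e)))

    long-edge-block-gaps : Rotation (T k) a b c → HasEdge (T k) x y → LongGap ℓ (gap x y) →
                           gap a b ≡ 1 ⊎ LongGap ℓ (gap a b)
    long-edge-block-gaps {k} {a} {b} {c} r xy long =
      unit-block-gaps q (subst (λ k′ → Rotation (T k′) a b c) (same-block (long-gap⇒≢ long) xy xy∈q) r)
      where
      q = proj₁ (long-edge-in-unit-block long refl)
      xy∈q = proj₂ (long-edge-in-unit-block long refl)

    long-gap-block-gaps : Rotation (T k) a b c → LongGap ℓ (gap b c) ⊎ LongGap ℓ (gap c a) →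
                          gap a b ≡ 1 ⊎ LongGap ℓ (gap a b)
    long-gap-block-gaps r (inj₁ long) = long-edge-block-gaps r (rotation-edge (rotate r)) long
    long-gap-block-gaps r (inj₂ long) = long-edge-block-gaps r (rotation-edge (rotate (rotate r))) long

    module _ (4≤ℓ : 4 ≤ ℓ) where

      3<v : 3 < v
      3<v = subst (3 <_) (sym even) (≤-trans 4≤ℓ (m≤m+n ℓ ℓ))

      two-steps : gap a b ≡ 1 → gap b c ≡ 1 → gap a c ≡ 2
      two-steps ab bc = trans (gap-+ (subst₂ (λ g h → g + h < v) (sym ab) (sym bc) (<-trans (n<1+n 2) 3<v)))
                              (cong₂ _+_ ab bc)

      -- If the block through (a, c) were contained, one of its other gaps would be ℓ − 1 or ℓ, making it
      -- a unit block, which has no gap 2; so it wraps around twice and its apex is b.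
      skip-apex : gap a b ≡ 1 → gap b c ≡ 1 → Rotation (T k) a c x → x ≡ b
      skip-apex {a} {b} {c} {k} {x} ab bc r = [ contained , wrapped ]′ (gap-cycle a≢c)
        where
        ac = two-steps ab bc
        a≢c = positive-gap⇒≢ (subst (0 <_) (sym ac) z<s)
        from-two : ∀ {s} → gap a c + gap c x + gap x a ≡ s → 2 + gap c x + gap x a ≡ s
        from-two = trans (cong (λ g → g + gap c x + gap x a) (sym ac))
        not-a-unit-block-gap : gap a c ≡ 1 ⊎ LongGap ℓ (gap a c) → ⊥
        not-a-unit-block-gap (inj₁ ac≡1) with trans (sym ac) ac≡1
        ... | ()
        not-a-unit-block-gap (inj₂ long) = <-irrefl refl (≤-trans 4≤ℓ (long-gap-bound (subst (LongGap ℓ) ac long)))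
        contained : gap a c + gap c x + gap x a ≡ v → x ≡ b
        contained s = ⊥-elim (not-a-unit-block-gap (long-gap-block-gaps r
          (skip-long-gaps (subst (λ g → ℓ ≤ gap x a + g) ac (proj₁ (proj₂ (window-bounds r s))))
                          (subst (λ g → ℓ ≤ g + gap c x) ac (proj₂ (proj₂ (window-bounds r s))))
                          (trans (from-two s) even))))
        wrapped : gap a c + gap c x + gap x a ≡ v + v → x ≡ b
        wrapped s = gap-injectiveˡ (suc-injective (trans (double-sum-maximal gap<v gap<v (from-two s))
          (sym (trans (cong (_+ gap b a) (sym ab)) (gap-flip (unit-gap⇒≢ ab))))))

      skip-block : gap a b ≡ 1 → gap b c ≡ 1 → Σ (Fin m) λ k → Rotation (T k) a c b
      skip-block {a} {b} {c} ab bc =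
        let (k , x , r) = block-of-edge (positive-gap⇒≢ (subst (0 <_) (sym (two-steps ab bc)) z<s))
        in k , subst (Rotation (T k) a c) (skip-apex ab bc r) r

      ℓ≥4-impossible : ⊥
      ℓ≥4-impossible =
        from-edge (rotation-edge⁻ r₀ (subst (λ k → HasEdge (T k) x₁ x₃) (sym k₀≡k₁) (rotation-edge r₁)))
        where
        x₀ = origin
        x₁ = proj₁ (successor x₀)
        x₂ = proj₁ (successor x₁)
        x₃ = proj₁ (successor x₂)
        u₀ = proj₂ (successor x₀)
        u₁ = proj₂ (successor x₁)
        u₂ = proj₂ (successor x₂)
        k₀ = proj₁ (skip-block u₀ u₁)
        r₀ = proj₂ (skip-block u₀ u₁)
        k₁ = proj₁ (skip-block u₁ u₂)
        r₁ = proj₂ (skip-block u₁ u₂)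
        k₀≡k₁ : k₀ ≡ k₁
        k₀≡k₁ = same-block (λ x₂≡x₁ → unit-gap⇒≢ u₁ (sym x₂≡x₁))
                           (rotation-edge (rotate r₀)) (rotation-edge (rotate (rotate r₁)))
        from-edge : HasEdge (x₀ , x₂ , x₁) x₁ x₃ → ⊥
        from-edge (inj₁ (x₁≡x₀ , _)) = unit-gap⇒≢ u₀ (sym x₁≡x₀)
        from-edge (inj₂ (inj₁ (x₁≡x₂ , _))) = unit-gap⇒≢ u₁ x₁≡x₂
        from-edge (inj₂ (inj₂ (_ , x₃≡x₀))) = <-irrefl three≡v 3<v
          where
          three≡v : 3 ≡ v
          three≡v = trans (cong₂ _+_ (sym (two-steps u₀ u₁)) (sym (subst (λ y → gap x₂ y ≡ 1) x₃≡x₀ u₂)))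
                          (gap-flip (positive-gap⇒≢ (subst (0 <_) (sym (two-steps u₀ u₁)) z<s)))

    ℓ≡3-impossible : ℓ ≡ 3 → ⊥
    ℓ≡3-impossible ℓ≡3 = [ contained , wrapped ]′ (gap-cycle p′≢p)
      where
      v≡6 : v ≡ 6
      v≡6 = trans even (cong₂ _+_ ℓ≡3 ℓ≡3)
      p = origin
      p′ = proj₁ (successor p)
      pp′ = proj₂ (successor p)
      p′≢p : p′ ≢ p
      p′≢p p′≡p = unit-gap⇒≢ pp′ (sym p′≡p)
      p′p≡5 : gap p′ p ≡ 5
      p′p≡5 = suc-injective (trans (cong (_+ gap p′ p) (sym pp′)) (trans (gap-flip (unit-gap⇒≢ pp′)) v≡6))
      i = proj₁ (block-of-edge p′≢p)
      z = proj₁ (proj₂ (block-of-edge p′≢p))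
      r = proj₂ (proj₂ (block-of-edge p′≢p))
      from-five : ∀ {s} → gap p′ p + gap p z + gap z p′ ≡ s → 5 + (gap p z + gap z p′) ≡ s
      from-five = trans (cong (λ g → g + gap p z + gap z p′) (sym p′p≡5))
      contained : gap p′ p + gap p z + gap z p′ ≡ v → ⊥
      contained s = <-irrefl (sym (+-cancelˡ-≡ 5 _ 1 (trans (from-five s) v≡6)))
        (+-mono-≤ (gap-positive p≢z) (gap-positive z≢p′))
        where
        p≢z = proj₁ (proj₂ (rotation-distinct r (distinct i)))
        z≢p′ = proj₂ (proj₂ (rotation-distinct r (distinct i)))
      wrapped : gap p′ p + gap p z + gap z p′ ≡ v + v → ⊥
      wrapped s = not-a-unit-block-gap (long-gap-block-gaps r
        (subst (λ l → LongGap l (gap p z) ⊎ LongGap l (gap z p′)) (sym ℓ≡3) long))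
        where
        sum7 : gap p z + gap z p′ ≡ 7
        sum7 = +-cancelˡ-≡ 5 (gap p z + gap z p′) 7 (trans (from-five s) (cong₂ _+_ v≡6 v≡6))
        long : LongGap 3 (gap p z) ⊎ LongGap 3 (gap z p′)
        long = seven-long-gaps (gap p z) (gap z p′) sum7
                               (subst (gap p z <_) v≡6 gap<v) (subst (gap z p′ <_) v≡6 gap<v)
        not-a-unit-block-gap : gap p′ p ≡ 1 ⊎ LongGap ℓ (gap p′ p) → ⊥
        not-a-unit-block-gap (inj₁ p′p≡1) = 0≢1+n (suc-injective (trans (sym p′p≡1) p′p≡5))
        not-a-unit-block-gap (inj₂ long) = [ (λ ()) , (λ ()) ]′ (subst₂ LongGap ℓ≡3 p′p≡5 long)

  impossible : ⊥
  impossible = [ even-impossible , odd-impossible ]′ parity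
    where
    even-impossible : v ≡ ℓ + ℓ → ⊥
    even-impossible even =
      [ Even.ℓ≥4-impossible even , (λ 3≡ℓ → Even.ℓ≡3-impossible even (sym 3≡ℓ)) ]′ (m≤n⇒m<n∨m≡n 3≤ℓ)

double≤⇒≤half : ∀ {ℓ n} → ℓ + ℓ ≤ n → ℓ ≤ n / 2
double≤⇒≤half {ℓ} {n} ℓ+ℓ≤n =
  subst (_≤ n / 2) (m*n/n≡m ℓ 2) (/-monoˡ-≤ 2 (≤-trans (≤-reflexive ℓ*2≡ℓ+ℓ) ℓ+ℓ≤n))
  where
  ℓ*2≡ℓ+ℓ : ℓ * 2 ≡ ℓ + ℓ
  ℓ*2≡ℓ+ℓ = trans (*-comm ℓ 2) (cong (ℓ +_) (+-identityʳ ℓ))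

mainTheorem3 : (v ℓ : ℕ) → 2 ≤ v → 3 ≤ ℓ → (S : MTS v) → (D : Sequencing v) →
    Good S ℓ D → ℓ ≤ (v ∸ 1) / 2
mainTheorem3 v ℓ 2≤v 3≤ℓ S D good with ℓ + ℓ <? v
... | yes ℓ+ℓ<v = double≤⇒≤half (<⇒≤pred ℓ+ℓ<v)
... | no ℓ+ℓ≮v =
  ⊥-elim (LongWindow.impossible {{>-nonZero (<-trans z<s 2≤v)}} S D good 3≤ℓ (≮⇒≥ ℓ+ℓ≮v) 2≤v)
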